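{- Let $G$ be a connected graph with at least one edge, and let $\Delta(G)$ be its maximum vertex degree. If $0<\beta<\frac{1}{\Delta(G)}$, then $\beta\text{ -pack}(G)=0$.
   Context: Let $G=(V,E)$ be a graph, $N(v)=\{u : uv\in E\}$ the open neighborhood of $v$, and fix $\beta$ with $0<\beta\le 1$. A set $S\subsetneq V$ (a proper subset) is a $\beta$-packing set of $G$ if (i) for every $v\in V-S$, $|N(v)\cap S|\le \beta\,|N(v)|$, and (ii) $S$ is maximal with respect to inclusion among proper subsets of $V$ having property (i). The $\beta$-packing number $\beta\text{ -pack}(G)$ is the maximum cardinality of a $\beta$-packing set of $G$. -}

module Defs where

open import Data.Nat using (ℕ; _⊔_)
open import Data.Fin using (Fin)
open import Data.Fin.Subset using (Subset; _∈_; _∉_; _⊆_; _∩_; ∣_∣)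
open import Data.Bool using (Bool; true; false)
open import Data.Vec using (tabulate)
open import Data.List using (List; foldr; map; allFin)
open import Data.Integer using (+_)
open import Data.Rational using (ℚ; _/_; _*_; _≤_)
open import Data.Product using (Σ; ∃; _×_)
open import Relation.Binary.PropositionalEquality using (_≡_)
open import Relation.Nullary using (¬_)

record Graph (n : ℕ) : Set where
  field
    adj   : Fin n → Fin n → Bool
    sym   : ∀ u v → adj u v ≡ adj v u
    irrefl : ∀ v → adj v v ≡ false
open Graph public

⟦_⟧ : ℕ → ℚ
⟦ k ⟧ = + k / 1

module _ {n : ℕ} (G : Graph n) where

  Edge : Fin n → Fin n → Set
  Edge u v = adj G u v ≡ true

  N : Fin n → Subset n
  N v = tabulate (λ u → adj G v u)

  deg : Fin n → ℕ
  deg v = ∣ N v ∣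

  -- maximum degree Δ(G) (0 for the empty vertex set)
  Δ : ℕ
  Δ = foldr _⊔_ 0 (map deg (allFin n))

  data Reachable : Fin n → Fin n → Set where
    here : ∀ {v} → Reachable v v
    step : ∀ {u w v} → Edge u w → Reachable w v → Reachable u v

  Connected : Set
  Connected = ∀ u v → Reachable u v

  HasEdge : Set
  HasEdge = Σ (Fin n) λ u → Σ (Fin n) λ v → Edge u v

  Proper : Subset n → Set
  Proper S = Σ (Fin n) λ v → v ∉ S

  BetaCond : ℚ → Subset n → Set
  BetaCond β S = ∀ v → v ∉ S → ⟦ ∣ N v ∩ S ∣ ⟧ ≤ β * ⟦ ∣ N v ∣ ⟧

  IsBetaPacking : ℚ → Subset n → Set
  IsBetaPacking β S =
    Proper S × BetaCond β S ×
    (∀ T → Proper T → BetaCond β T → S ⊆ T → T ≡ S)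

  IsBetaPackNumber : ℚ → ℕ → Set
  IsBetaPackNumber β k =
    (Σ (Subset n) λ S → IsBetaPacking β S × ∣ S ∣ ≡ k) ×
    (∀ S → IsBetaPacking β S → Data.Nat._≤_ ∣ S ∣ k)

-- Since β Δ(G) < 1, condition (i) at a vertex v ∉ S gives |N(v) ∩ S| ≤ β |N(v)| < 1,
-- so no vertex outside S has a neighbour in S. Walks starting outside S thus never
-- enter S, and in a connected graph every proper set with property (i) is empty.
-- The empty set has property (i) and is proper since G has a vertex, so it is the
-- only β-packing set.
module Submission where

open import Defs
open import Data.Nat using (ℕ)
open import Data.Rational using (ℚ; 0ℚ; 1ℚ; _<_; _≤_; _*_)

open import Data.Nat as ℕ using (z≤n)
import Data.Nat.Properties as ℕ
import Data.Integer as ℤ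
import Data.Integer.Properties as ℤ
open import Data.Nat.Coprimality as Coprimality using (1-coprimeTo)
open import Data.Rational using (mkℚ; *≤*; NonNegative; positive)
open import Data.Rational.Properties
  using (normalize-coprime; *-monoˡ-≤-nonNeg; *-zeroʳ; <-irrefl; pos⇒nonNeg; module ≤-Reasoning)
open import Data.Fin using (Fin)
open import Data.Fin.Subset using (Subset; _∈_; _∉_; _∩_; ∣_∣; ⊥; ⁅_⁆)
open import Data.Fin.Subset.Properties
  using (Empty-unique; ∉⊥; ∣⊥∣≡0; ∩-zeroʳ; x∈p∩q⁺; x∈⁅y⁆⇒x≡y; ∣⁅x⁆∣≡1; p⊆q⇒∣p∣≤∣q∣)
open import Data.Vec.Properties using (lookup⇒[]=; lookup∘tabulate)
open import Data.List using (List; _∷_; foldr; map; allFin)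
open import Data.List.Relation.Unary.Any using (here; there)
open import Data.List.Membership.Propositional using () renaming (_∈_ to _∈ₗ_)
open import Data.List.Membership.Propositional.Properties using (∈-allFin; ∈-map⁺)
open import Data.Product using (_,_)
open import Relation.Binary.PropositionalEquality as ≡ using (_≡_; refl; trans; cong; subst)

⟦⟧≡mkℚ : ∀ k → ⟦ k ⟧ ≡ mkℚ (ℤ.+ k) 0 (Coprimality.sym (1-coprimeTo k))
⟦⟧≡mkℚ k = normalize-coprime (Coprimality.sym (1-coprimeTo k))

⟦⟧-mono-≤ : ∀ {a b} → a ℕ.≤ b → ⟦ a ⟧ ≤ ⟦ b ⟧
⟦⟧-mono-≤ {a} {b} a≤b rewrite ⟦⟧≡mkℚ a | ⟦⟧≡mkℚ b =
  *≤* (ℤ.*-monoʳ-≤-nonNeg (ℤ.+ 1) (ℤ.+≤+ a≤b))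

x∈p⇒1≤∣p∣ : ∀ {n} {x : Fin n} {p : Subset n} → x ∈ p → 1 ℕ.≤ ∣ p ∣
x∈p⇒1≤∣p∣ {x = x} x∈p =
  subst (ℕ._≤ _) (∣⁅x⁆∣≡1 x) (p⊆q⇒∣p∣≤∣q∣ λ y∈⁅x⁆ → subst (_∈ _) (≡.sym (x∈⁅y⁆⇒x≡y x y∈⁅x⁆)) x∈p)

x∈xs⇒x≤foldr-⊔ : ∀ {x} (xs : List ℕ) → x ∈ₗ xs → x ℕ.≤ foldr ℕ._⊔_ 0 xs
x∈xs⇒x≤foldr-⊔ (y ∷ ys) (here refl) = ℕ.m≤m⊔n y _
x∈xs⇒x≤foldr-⊔ (y ∷ ys) (there x∈ys) = ℕ.≤-trans (x∈xs⇒x≤foldr-⊔ ys x∈ys) (ℕ.m≤n⊔m y _)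

module _ {n : ℕ} (G : Graph n) where

  deg≤Δ : ∀ v → deg G v ℕ.≤ Δ G
  deg≤Δ v = x∈xs⇒x≤foldr-⊔ (map (deg G) (allFin n)) (∈-map⁺ (deg G) (∈-allFin v))

  Edge⇒∈N : ∀ {u v} → Edge G u v → v ∈ N G u
  Edge⇒∈N {u} {v} e = lookup⇒[]= v _ (trans (lookup∘tabulate (adj G u) v) e)

  Reachable-preserves-∉ : ∀ {S : Subset n} →
    (∀ {u v} → Edge G u v → u ∉ S → v ∉ S) →
    ∀ {u v} → Reachable G u v → u ∉ S → v ∉ S
  Reachable-preserves-∉ closed here          u∉S = u∉S
  Reachable-preserves-∉ closed (step e walk) u∉S =
    Reachable-preserves-∉ closed walk (closed e u∉S)

  Connected⇒proper-closed≡⊥ : Connected G → ∀ {S : Subset n} → Proper G S →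
    (∀ {u v} → Edge G u v → u ∉ S → v ∉ S) → S ≡ ⊥
  Connected⇒proper-closed≡⊥ connected (u , u∉S) closed =
    Empty-unique λ { (v , v∈S) → Reachable-preserves-∉ closed (connected u v) u∉S v∈S }

  BetaCond-⊥ : ∀ β .{{_ : NonNegative β}} → BetaCond G β ⊥
  BetaCond-⊥ β v _ = begin
    ⟦ ∣ N G v ∩ ⊥ ∣ ⟧ ≡⟨ cong (λ S → ⟦ ∣ S ∣ ⟧) (∩-zeroʳ (N G v)) ⟩
    ⟦ ∣ ⊥ {n} ∣ ⟧     ≡⟨ cong ⟦_⟧ (∣⊥∣≡0 n) ⟩
    0ℚ                ≡⟨ ≡.sym (*-zeroʳ β) ⟩
    β * 0ℚ            ≤⟨ *-monoˡ-≤-nonNeg β (⟦⟧-mono-≤ {b = deg G v} z≤n) ⟩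
    β * ⟦ deg G v ⟧   ∎
    where open ≤-Reasoning

  BetaCond⇒closed : ∀ {β} .{{_ : NonNegative β}} → β * ⟦ Δ G ⟧ < 1ℚ →
    ∀ {S} → BetaCond G β S → ∀ {u v} → Edge G u v → u ∉ S → v ∉ S
  BetaCond⇒closed {β} βΔ<1 {S} cond {u} e u∉S v∈S = <-irrefl refl (begin-strict
    1ℚ                ≤⟨ ⟦⟧-mono-≤ (x∈p⇒1≤∣p∣ {p = N G u ∩ S} (x∈p∩q⁺ (Edge⇒∈N e , v∈S))) ⟩
    ⟦ ∣ N G u ∩ S ∣ ⟧ ≤⟨ cond u u∉S ⟩
    β * ⟦ deg G u ⟧   ≤⟨ *-monoˡ-≤-nonNeg β (⟦⟧-mono-≤ (deg≤Δ u)) ⟩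
    β * ⟦ Δ G ⟧       <⟨ βΔ<1 ⟩
    1ℚ                ∎)
    where open ≤-Reasoning

proposition3p3 : {n : ℕ} (G : Graph n) (β : ℚ) →
    0ℚ < β → β ≤ 1ℚ →
    Connected G → HasEdge G →
    β * ⟦ Δ G ⟧ < 1ℚ →
    IsBetaPackNumber G β 0
proposition3p3 {n} G β 0<β _ connected (u , _) βΔ<1 =
  (⊥ , (⊥-proper , BetaCond-⊥ G β , λ T T-proper T-cond _ → only-⊥ T-proper T-cond) , ∣⊥∣≡0 n)
  , λ S (S-proper , S-cond , _) → ℕ.≤-reflexive (trans (cong ∣_∣ (only-⊥ S-proper S-cond)) (∣⊥∣≡0 n))
  where
  instance
    β≥0 : NonNegative β
    β≥0 = pos⇒nonNeg β {{positive 0<β}}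

  ⊥-proper : Proper G ⊥
  ⊥-proper = u , ∉⊥

  only-⊥ : ∀ {S} → Proper G S → BetaCond G β S → S ≡ ⊥
  only-⊥ S-proper S-cond =
    Connected⇒proper-closed≡⊥ G connected S-proper (BetaCond⇒closed G {β} βΔ<1 S-cond)
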